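{- Let an instance of scheduling on $m$ identical machines $M_1,\dots,M_m$ be given, with jobs $J$, processing times $p_j\in\mathbb{N}$, and a conflict graph $G=(J,E)$ that is a block graph with $k$ blocks. Run the greedy algorithm described in the context, and let $B^{(1)},\dots,B^{(k)}$ be the order in which it processes the blocks. For $j\in\{0,\dots,k\}$ let $C_j(M_i)$ be the load (total processing time of assigned jobs) of $M_i$ after the first $j$ blocks have been processed, let $C_j=\frac1m\sum_{i=1}^m C_j(M_i)$, and let $p_{\max}=\max_j p_j$. Then for every $i\in\{1,\dots,m\}$ and every $j\in\{0,\dots,k\}$, $$C_j(M_i)\le C_j+\max\{C_j,p_{\max}\}.$$
   Context: A block graph is a graph in which every maximal 2-connected subgraph is a clique; these maximal cliques are the blocks. A vertex belonging to more than one block is a cut-vertex. The block-cut forest $T_G$ has one node per block and one node per cut-vertex, with a block node adjacent to a cut-vertex node iff the cut-vertex lies in the block; each component is rooted. A schedule assigns each job to a machine so that adjacent jobs of $G$ go to different machines; the load of a machine is the sum of processing times of its jobs. The greedy algorithm: process the blocks in the order of a pre-order traversal of all components of $T_G$. For the current block $B$: sort the jobs of $B$ by non-increasing processing time into a list $L_J$; take the $|B|$ machines with smallest current loads (ties broken arbitrarily), ordered by non-decreasing load, as a list $L_M$. If $B$ has a parent cut-vertex $u$ in $T_G$ that is already assigned to some machine $M'$, then: if $M'\in L_M$ remove $M'$ from $L_M$, otherwise remove the last machine from $L_M$; and remove $u$ from $L_J$. Then for $i=1,\dots,|L_M|$ assign the $i$-th job of $L_J$ to the $i$-th machine of $L_M$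 and update its load. -}

module Defs where

open import Data.Nat using (ℕ; zero; suc; _+_; _*_; _≤_; _⊔_)
open import Data.Fin using (Fin)
open import Data.Fin.Properties using (_≟_)
open import Data.Fin.Subset using (Subset; Nonempty; _-_; ∣_∣)
  renaming (_∈_ to _∈ₛ_; _⊆_ to _⊆ₛ_)
open import Data.Fin.Subset.Properties using () renaming (_∈?_ to _∈ₛ?_)
open import Data.Nat.ListAction using (sum)
open import Data.List using (List; []; _∷_; _++_; map; filter; foldr; length; zip; allFin)
open import Data.List.Membership.Propositional using (_∈_)
open import Data.List.Relation.Unary.Unique.Propositional using (Unique)
open import Data.List.Relation.Unary.Linked using (Linked)
open import Data.List.Relation.Binary.Permutation.Propositional using (_↭_)
open import Data.List.Relation.Unary.Any using (any?)
open import Data.Maybe using (Maybe; just; nothing)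
open import Data.Maybe.Properties using (≡-dec)
open import Data.Product using (_×_; _,_; ∃; Σ; proj₁; proj₂)
open import Data.Sum using (_⊎_)
open import Data.Empty using (⊥)
open import Relation.Nullary using (¬_; yes; no; ¬?)
open import Relation.Binary.PropositionalEquality using (_≡_; _≢_)

-- Simple graphs on the vertex set Fin n (vertices = jobs)

record Graph (n : ℕ) : Set₁ where
  field
    Adj    : Fin n → Fin n → Set
    sym    : ∀ {x y} → Adj x y → Adj y x
    irrefl : ∀ {x} → ¬ Adj x x
open Graph public

module _ {n : ℕ} (G : Graph n) where

  data Walk (S : Subset n) : Fin n → Fin n → Set where
    here  : ∀ {x} → x ∈ₛ S → Walk S x x
    there : ∀ {x y z} → x ∈ₛ S → Adj G x y → Walk S y z → Walk S x z

  ConnectedIn : Subset n → Set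
  ConnectedIn S = ∀ x y → x ∈ₛ S → y ∈ₛ S → Walk S x y

  -- G[S] is nonempty, connected and has no cut-vertex
  -- (the usual notion of a 2-connected piece / block, including K1 and K2)
  Biconnected : Subset n → Set
  Biconnected S = Nonempty S × ConnectedIn S × (∀ v → v ∈ₛ S → ConnectedIn (S - v))

  IsBlock : Subset n → Set
  IsBlock S = Biconnected S × (∀ T → S ⊆ₛ T → Biconnected T → T ⊆ₛ S)

  IsClique : Subset n → Set
  IsClique S = ∀ x y → x ∈ₛ S → y ∈ₛ S → x ≢ y → Adj G x y

  IsBlockGraph : Set
  IsBlockGraph = ∀ S → IsBlock S → IsClique S

  IsCutVertex : Fin n → Set
  IsCutVertex v = ∃ λ S → ∃ λ T → S ≢ T × IsBlock S × IsBlock T × v ∈ₛ S × v ∈ₛ T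

data RTree (A : Set) : Set where
  node : A → List (RTree A) → RTree A

mutual
  preorder : {A : Set} → Maybe A → RTree A → List (Maybe A × A)
  preorder p (node x ts) = (p , x) ∷ preorderF (just x) ts

  preorderF : {A : Set} → Maybe A → List (RTree A) → List (Maybe A × A)
  preorderF p []       = []
  preorderF p (t ∷ ts) = preorder p t ++ preorderF p ts

data TNode (n : ℕ) : Set where
  blk : Subset n → TNode n
  cut : Fin n → TNode n

Forest : ℕ → Set
Forest n = List (RTree (TNode n))

entries : ∀ {n} → Forest n → List (Maybe (TNode n) × TNode n)
entries F = preorderF nothing F

module _ {n : ℕ} (G : Graph n) where

  IsTGNode : TNode n → Set
  IsTGNode (blk S) = IsBlock G S
  IsTGNode (cut v) = IsCutVertex G v

  -- adjacency in T_G (one orientation)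
  TGEdge : TNode n → TNode n → Set
  TGEdge (blk S) (cut v) = v ∈ₛ S
  TGEdge _       _       = ⊥

  -- F is (a rooting, with an ordering of children, of) the block-cut forest T_G
  IsBlockCutForest : Forest n → Set
  IsBlockCutForest F =
      Unique (map proj₂ (entries F))
    × (∀ x → x ∈ map proj₂ (entries F) → IsTGNode x)
    × (∀ x → IsTGNode x → x ∈ map proj₂ (entries F))
    × (∀ a b → (just a , b) ∈ entries F → TGEdge a b ⊎ TGEdge b a)
    × (∀ S v → IsBlock G S → IsCutVertex G v → v ∈ₛ S →
         (just (blk S) , cut v) ∈ entries F ⊎ (just (cut v) , blk S) ∈ entries F)

blockSeq' : ∀ {n} → List (Maybe (TNode n) × TNode n) → List (Subset n × Maybe (Fin n))
blockSeq' []                              = []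
blockSeq' ((just (cut v) , blk S) ∷ es)   = (S , just v) ∷ blockSeq' es
blockSeq' ((_ , blk S) ∷ es)              = (S , nothing) ∷ blockSeq' es
blockSeq' ((_ , cut _) ∷ es)              = blockSeq' es

blockSeq : ∀ {n} → Forest n → List (Subset n × Maybe (Fin n))
blockSeq F = blockSeq' (entries F)

Assign : ℕ → ℕ → Set
Assign n m = Fin n → Maybe (Fin m)

emptyAssign : ∀ {n m} → Assign n m
emptyAssign _ = nothing

load : ∀ {n m} → (Fin n → ℕ) → Assign n m → Fin m → ℕ
load {n} p a M = sum (map p (filter (λ j → ≡-dec _≟_ (a j) (just M)) (allFin n)))

totalLoad : ∀ {n m} → (Fin n → ℕ) → Assign n m → ℕ
totalLoad {m = m} p a = sum (map (load p a) (allFin m))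

pmax : ∀ {n} → (Fin n → ℕ) → ℕ
pmax {n} p = foldr _⊔_ 0 (map p (allFin n))

jobsOf : ∀ {n} → Subset n → List (Fin n)
jobsOf {n} B = filter (_∈ₛ? B) (allFin n)

dropLast : {A : Set} → List A → List A
dropLast []           = []
dropLast (x ∷ [])     = []
dropLast (x ∷ y ∷ xs) = x ∷ dropLast (y ∷ xs)

removeMachine : ∀ {m} → Fin m → List (Fin m) → List (Fin m)
removeMachine M' LM with any? (λ x → M' ≟ x) LM
... | yes _ = filter (λ x → ¬? (x ≟ M')) LM
... | no  _ = dropLast LM

-- treatment of the parent cut-vertex u (if it exists and is already assigned)
adjust : ∀ {n m} → Assign n m → Maybe (Fin n) → List (Fin n) → List (Fin m)
       → List (Fin n) × List (Fin m)
adjust a nothing  LJ LM = LJ , LM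
adjust a (just u) LJ LM with a u
... | nothing = LJ , LM
... | just M' = filter (λ x → ¬? (x ≟ u)) LJ , removeMachine M' LM

lookupJob : ∀ {n m} → List (Fin n × Fin m) → Fin n → Maybe (Fin m)
lookupJob []              j = nothing
lookupJob ((j' , M) ∷ ps) j with j' ≟ j
... | yes _ = just M
... | no  _ = lookupJob ps j

applyPairs : ∀ {n m} → Assign n m → List (Fin n × Fin m) → Assign n m
applyPairs a ps j with lookupJob ps j
... | just M  = just M
... | nothing = a j

next : ∀ {n m} → Assign n m → Maybe (Fin n) → List (Fin n) → List (Fin m) → Assign n m
next a u LJ LM = applyPairs a (zip (proj₁ (adjust a u LJ LM)) (proj₂ (adjust a u LJ LM)))

ValidChoice : ∀ {n m} → (Fin n → ℕ) → Assign n m → Subset n → List (Fin n) → List (Fin m) → Set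
ValidChoice p a B LJ LM =
    (LJ ↭ jobsOf B)
  × Linked (λ x y → p y ≤ p x) LJ
  × Unique LM
  × length LM ≡ ∣ B ∣
  × Linked (λ x y → load p a x ≤ load p a y) LM
  × (∀ x y → x ∈ LM → ¬ (y ∈ LM) → load p a x ≤ load p a y)

-- Run p a bs as : starting from a, processing the blocks bs (with parent
-- cut-vertices) yields the list of successive states as (including a)
data Run {n m : ℕ} (p : Fin n → ℕ) : Assign n m → List (Subset n × Maybe (Fin n))
       → List (Assign n m) → Set where
  done : ∀ {a} → Run p a [] (a ∷ [])
  step : ∀ {a B u bs as} (LJ : List (Fin n)) (LM : List (Fin m))
       → ValidChoice p a B LJ LM
       → Run p (next a u LJ LM) bs as
       → Run p a ((B , u) ∷ bs) (a ∷ as)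

module Submission where

-- For loads ℓ and P = pmax p call ℓ balanced when, for every machine i and every
-- set S of other machines, (|S| − 1) · (ℓ i ∸ P) ≤ Σ_{y ∈ S} ℓ y.  The empty schedule
-- is balanced, and so is every later one: a block puts at most one job on each
-- machine, its jobs go largest first to the least loaded machines, so every machine
-- less loaded than i, except possibly the one withheld for the parent cut-vertex,
-- gains at least as much as i, while every machine at least as loaded as i already
-- carries ℓ i, which bounds the new excess of i over P.  The parent cut-vertex is the
-- only job of a block that was scheduled before, because a pre-order traversal lists
-- every parent before its children.  Taking S to be all machines other than i gives
-- (m − 2) · (ℓ i ∸ P) ≤ T − ℓ i for the total load T, and comparing ℓ i with 2P
-- turns this into the claimed bound.

open import Defs hiding (sym)

import Algebra.Properties.CommutativeSemigroup as CommutativeSemigroupProperties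
open import Data.Empty using (⊥; ⊥-elim)
open import Data.Fin using (Fin)
open import Data.Fin.Properties using (_≟_)
open import Data.Fin.Subset using (Subset) renaming (_∈_ to _∈ₛ_)
open import Data.Fin.Subset.Properties using () renaming (_∈?_ to _∈ₛ?_)
open import Data.List using (List; []; _∷_; _++_; map; filter; foldr; length; allFin; zip; last)
open import Data.List.Membership.Propositional using (_∈_; _∉_)
open import Data.List.Membership.Propositional.Properties
  using (∈-filter⁻; ∈-filter⁺; ∈-allFin; ∈-map⁺; ∈-++⁺ˡ; ∈-++⁺ʳ; ∈-++⁻)
open import Data.List.Properties
  using (map-++; ++-assoc; filter-accept; filter-reject; filter-none; length-tabulate; map-cong)
open import Data.List.Relation.Binary.Permutation.Propositional using (↭-sym; ↭⇒↭ₛ)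
open import Data.List.Relation.Binary.Permutation.Propositional.Properties using (∈-resp-↭)
open import Data.List.Relation.Binary.Permutation.Setoid.Properties using (Unique-resp-↭)
open import Data.List.Relation.Binary.Sublist.Propositional using (_⊆_; []; _∷_; _∷ʳ_; ⊆-refl; ⊆-trans; minimum)
open import Data.List.Relation.Binary.Sublist.Propositional.Properties using (All-resp-⊆; Any-resp-⊆; filter-⊆)
open import Data.List.Relation.Unary.All as All using (All; []; _∷_)
open import Data.List.Relation.Unary.AllPairs using (AllPairs; []; _∷_)
open import Data.List.Relation.Unary.Any using (here; there; any?)
open import Data.List.Relation.Unary.Linked.Properties using (Linked⇒AllPairs)
open import Data.List.Relation.Unary.Unique.Propositional using (Unique)
import Data.List.Relation.Unary.Unique.Propositional.Properties as Unique
open import Data.Maybe using (Maybe; just; nothing)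
open import Data.Maybe.Properties using (≡-dec; just-injective)
import Data.Maybe.Relation.Unary.All as Maybe
open import Data.Nat using (ℕ; zero; suc; _+_; _*_; _∸_; _≤_; _<_; _⊔_; z≤n; _≤?_)
open import Data.Nat.ListAction using (sum)
open import Data.Nat.Properties hiding (_≟_)
open import Data.Nat.Solver using (module +-*-Solver)
open import Data.Product using (_×_; _,_; ∃; proj₁; proj₂)
open import Data.Sum using (_⊎_; inj₁; inj₂; [_,_]′)
open import Function using (_∘_; case_of_)
open import Relation.Binary.Definitions using (DecidableEquality)
open import Relation.Binary.PropositionalEquality
  using (_≡_; _≢_; refl; sym; trans; cong; cong₂; subst; subst₂; setoid; module ≡-Reasoning)
open import Relation.Nullary using (yes; no; ¬?)
open import Relation.Unary using (Pred; Decidable)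

open +-*-Solver using (solve; _:+_; _:=_)
open CommutativeSemigroupProperties +-commutativeSemigroup using (interchange; x∙yz≈y∙xz)

n≤o⇒m+n∸o≤m : ∀ m {n o} → n ≤ o → (m + n) ∸ o ≤ m
n≤o⇒m+n∸o≤m m {n} {o} n≤o = m≤n+o⇒m∸n≤o (m + n) o (≤-trans (+-monoʳ-≤ m n≤o) (≤-reflexive (+-comm m o)))

m+n∸o≤m∸o+n : ∀ m n o → (m + n) ∸ o ≤ (m ∸ o) + n
m+n∸o≤m∸o+n m n o = m≤n+o⇒m∸n≤o (m + n) o
  (≤-trans (+-monoˡ-≤ n (m≤n+m∸n m o)) (≤-reflexive (+-assoc o (m ∸ o) n)))

pred[m+n]≤m+pred[n] : ∀ m n → (m + n) ∸ 1 ≤ m + (n ∸ 1)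
pred[m+n]≤m+pred[n] m zero    = m∸n≤m (m + 0) 1
pred[m+n]≤m+pred[n] m (suc n) = ≤-reflexive (cong (_∸ 1) (+-suc m n))

module _ {A : Set} where

  sum-map-+ : ∀ (f g : A → ℕ) xs → sum (map (λ x → f x + g x) xs) ≡ sum (map f xs) + sum (map g xs)
  sum-map-+ f g []       = refl
  sum-map-+ f g (x ∷ xs) = trans (cong (f x + g x +_) (sum-map-+ f g xs)) (interchange (f x) (g x) _ _)

  length*≤sum : ∀ (f : A → ℕ) {c} xs → (∀ {y} → y ∈ xs → c ≤ f y) → length xs * c ≤ sum (map f xs)
  length*≤sum f []       c≤f = z≤n
  length*≤sum f (x ∷ xs) c≤f = +-mono-≤ (c≤f (here refl)) (length*≤sum f xs (c≤f ∘ there))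

  pred[length]*≤sum : DecidableEquality A → ∀ (f : A → ℕ) {c} (z : Maybe A) {xs} → Unique xs
                   → (∀ {y} → y ∈ xs → just y ≢ z → c ≤ f y) → (length xs ∸ 1) * c ≤ sum (map f xs)
  pred[length]*≤sum _≟ₐ_ f z {[]}     _           c≤f = z≤n
  pred[length]*≤sum _≟ₐ_ f z {x ∷ xs} (x∉ ∷ uxs) c≤f with ≡-dec _≟ₐ_ (just x) z
  ... | yes refl = ≤-trans (length*≤sum f xs λ y∈ → c≤f (there y∈) λ { refl → All.lookup x∉ y∈ refl })
                           (m≤n+m (sum (map f xs)) (f x))
  ... | no x≢z   = ≤-trans (length*≤c+pred[length]*c xs)
                           (+-mono-≤ (c≤f (here refl) x≢z) (pred[length]*≤sum _≟ₐ_ f z uxs (c≤f ∘ there)))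
    where
      length*≤c+pred[length]*c : ∀ (ys : List A) {c} → length ys * c ≤ c + (length ys ∸ 1) * c
      length*≤c+pred[length]*c []       = z≤n
      length*≤c+pred[length]*c (_ ∷ _)  = ≤-refl

module _ {A : Set} {ℓ} {P : Pred A ℓ} (P? : Decidable P) where

  length-filter-split : ∀ xs → length xs ≡ length (filter P? xs) + length (filter (¬? ∘ P?) xs)
  length-filter-split []       = refl
  length-filter-split (x ∷ xs) with P? x
  ... | yes _ = cong suc (length-filter-split xs)
  ... | no  _ = trans (cong suc (length-filter-split xs)) (sym (+-suc (length (filter P? xs)) _))

  sum-filter-split : ∀ (f : A → ℕ) xs → sum (map f xs) ≡ sum (map f (filter P? xs)) + sum (map f (filter (¬? ∘ P?) xs))
  sum-filter-split f []       = refl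
  sum-filter-split f (x ∷ xs) with P? x
  ... | yes _ = trans (cong (f x +_) (sum-filter-split f xs)) (sym (+-assoc (f x) _ _))
  ... | no  _ = trans (cong (f x +_) (sum-filter-split f xs)) (x∙yz≈y∙xz (f x) (sum (map f (filter P? xs))) _)

∈⇒≤foldr-⊔ : ∀ {x xs} → x ∈ xs → x ≤ foldr _⊔_ 0 xs
∈⇒≤foldr-⊔ {xs = y ∷ _} (here refl) = m≤m⊔n y _
∈⇒≤foldr-⊔ {xs = y ∷ _} (there x∈) = ≤-trans (∈⇒≤foldr-⊔ x∈) (m≤n⊔m y _)

p≤pmax : ∀ {n} (p : Fin n → ℕ) j → p j ≤ pmax p
p≤pmax p j = ∈⇒≤foldr-⊔ (∈-map⁺ p (∈-allFin j))

filter-≟-singleton : ∀ {m} {i : Fin m} {xs} → Unique xs → i ∈ xs → filter (_≟ i) xs ≡ i ∷ []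
filter-≟-singleton {i = i} (x∉ ∷ _) (here refl) =
  trans (filter-accept (_≟ i) refl) (cong (i ∷_) (filter-none (_≟ i) (All.map (λ i≢y y≡i → i≢y (sym y≡i)) x∉)))
filter-≟-singleton {i = i} {x ∷ xs} (x∉ ∷ uxs) (there i∈) =
  trans (filter-reject (_≟ i) {x} {xs} λ { refl → All.lookup x∉ i∈ refl }) (filter-≟-singleton uxs i∈)

module _ {m : ℕ} where

  Balanced : ℕ → (Fin m → ℕ) → Set
  Balanced P ℓ = ∀ i {S} → Unique S → i ∉ S → (length S ∸ 1) * (ℓ i ∸ P) ≤ sum (map ℓ S)

  Balanced-resp-≗ : ∀ {P} {ℓ ℓ′ : Fin m → ℕ} → (∀ k → ℓ k ≡ ℓ′ k) → Balanced P ℓ → Balanced P ℓ′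
  Balanced-resp-≗ {P} {ℓ} {ℓ′} ℓ≗ℓ′ bal i {S} uS i∉S =
    subst₂ (λ a b → (length S ∸ 1) * (a ∸ P) ≤ b) (ℓ≗ℓ′ i) (cong sum (map-cong ℓ≗ℓ′ S)) (bal i uS i∉S)

  balanced-zero : ∀ {P} → Balanced P (λ _ → 0)
  balanced-zero {P} i {S} _ _ =
    ≤-trans (≤-reflexive (trans (cong ((length S ∸ 1) *_) (0∸n≡0 P)) (*-zeroʳ (length S ∸ 1)))) z≤n

  balanced-+ : ∀ {P} {ℓ q : Fin m → ℕ} (z : Maybe (Fin m)) → (∀ k → q k ≤ P)
             → (∀ {i y} → ℓ y < ℓ i → just y ≢ z → q i ≤ q y)
             → Balanced P ℓ → Balanced P (λ k → ℓ k + q k)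
  balanced-+ {P} {ℓ} {q} z q≤P q-antitone bal i {S} uS i∉S = begin
    (length S ∸ 1) * x′                                 ≤⟨ *-monoˡ-≤ x′ length-split ⟩
    (length S₁ + (length S₂ ∸ 1)) * x′                  ≡⟨ *-distribʳ-+ x′ (length S₁) _ ⟩
    length S₁ * x′ + (length S₂ ∸ 1) * x′               ≤⟨ +-mono-≤ above below ⟩
    sum (map ℓ′ S₁) + sum (map ℓ′ S₂)                   ≡⟨ sum-filter-split above? ℓ′ S ⟨
    sum (map ℓ′ S)                                      ∎
    where
      open ≤-Reasoning
      ℓ′ : Fin m → ℕ
      ℓ′ k = ℓ k + q k
      x′ = ℓ′ i ∸ P
      above? = λ y → ℓ i ≤? ℓ y
      S₁ = filter above? S
      S₂ = filter (¬? ∘ above?) S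

      length-split : length S ∸ 1 ≤ length S₁ + (length S₂ ∸ 1)
      length-split = subst (λ l → l ∸ 1 ≤ length S₁ + (length S₂ ∸ 1)) (sym (length-filter-split above? S))
                       (pred[m+n]≤m+pred[n] (length S₁) (length S₂))

      above : length S₁ * x′ ≤ sum (map ℓ′ S₁)
      above = length*≤sum ℓ′ S₁ λ y∈ → ≤-trans (n≤o⇒m+n∸o≤m (ℓ i) (q≤P i))
                (≤-trans (proj₂ (∈-filter⁻ above? {xs = S} y∈)) (m≤m+n _ _))

      below : (length S₂ ∸ 1) * x′ ≤ sum (map ℓ′ S₂)
      below = begin
        (length S₂ ∸ 1) * x′
          ≤⟨ *-monoʳ-≤ (length S₂ ∸ 1) (m+n∸o≤m∸o+n (ℓ i) (q i) P) ⟩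
        (length S₂ ∸ 1) * ((ℓ i ∸ P) + q i)
          ≡⟨ *-distribˡ-+ (length S₂ ∸ 1) (ℓ i ∸ P) (q i) ⟩
        (length S₂ ∸ 1) * (ℓ i ∸ P) + (length S₂ ∸ 1) * q i
          ≤⟨ +-mono-≤ old-excess gain-below ⟩
        sum (map ℓ S₂) + sum (map q S₂)
          ≡⟨ sum-map-+ ℓ q S₂ ⟨
        sum (map ℓ′ S₂)
          ∎
        where
          uS₂ = Unique.filter⁺ (¬? ∘ above?) uS
          old-excess = bal i uS₂ (i∉S ∘ proj₁ ∘ ∈-filter⁻ (¬? ∘ above?) {xs = S})
          gain-below = pred[length]*≤sum _≟_ q z uS₂ λ y∈ →
            q-antitone (≰⇒> (proj₂ (∈-filter⁻ (¬? ∘ above?) {xs = S} y∈)))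

-- If ℓ ≤ 2P two copies of ℓ are charged to m·P, otherwise ℓ ≤ 2(ℓ ∸ P) and all is charged to T.
excess-bound⇒load-bound : ∀ s {ℓ P R} → (s ∸ 1) * (ℓ ∸ P) ≤ R → suc s * ℓ ≤ (R + ℓ) + ((R + ℓ) ⊔ suc s * P)
excess-bound⇒load-bound zero    {ℓ} {R = R} _ = ≤-trans (≤-reflexive (+-identityʳ ℓ)) (≤-trans (m≤n+m ℓ R) (m≤m+n _ _))
excess-bound⇒load-bound (suc t) {ℓ} {P} {R} t*excess≤R with ℓ ≤? P + P
... | yes ℓ≤2P = begin
  ℓ + (ℓ + t * ℓ)                 ≤⟨ +-monoʳ-≤ ℓ (+-mono-≤ ℓ≤2P t*ℓ≤) ⟩
  ℓ + ((P + P) + (R + t * P))     ≡⟨ rearrange ℓ P R (t * P) ⟩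
  (R + ℓ) + (P + (P + t * P))     ≤⟨ +-monoʳ-≤ (R + ℓ) (m≤n⊔m (R + ℓ) _) ⟩
  (R + ℓ) + ((R + ℓ) ⊔ (P + (P + t * P))) ∎
  where
    open ≤-Reasoning
    t*ℓ≤ : t * ℓ ≤ R + t * P
    t*ℓ≤ = begin
      t * ℓ                  ≤⟨ *-monoʳ-≤ t (m≤n+m∸n ℓ P) ⟩
      t * (P + (ℓ ∸ P))      ≡⟨ *-distribˡ-+ t P (ℓ ∸ P) ⟩
      t * P + t * (ℓ ∸ P)    ≤⟨ +-monoʳ-≤ (t * P) t*excess≤R ⟩
      t * P + R              ≡⟨ +-comm (t * P) R ⟩
      R + t * P              ∎
    rearrange : ∀ a b c d → a + ((b + b) + (c + d)) ≡ (c + a) + (b + (b + d))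
    rearrange = solve 4 (λ a b c d → a :+ ((b :+ b) :+ (c :+ d)) := (c :+ a) :+ (b :+ (b :+ d))) refl
... | no ℓ≰2P = begin
  ℓ + (ℓ + t * ℓ)                 ≤⟨ +-monoʳ-≤ ℓ (+-monoʳ-≤ ℓ t*ℓ≤2R) ⟩
  ℓ + (ℓ + (R + R))               ≡⟨ rearrange ℓ R ⟩
  (R + ℓ) + (R + ℓ)               ≤⟨ +-monoʳ-≤ (R + ℓ) (m≤m⊔n (R + ℓ) _) ⟩
  (R + ℓ) + ((R + ℓ) ⊔ (P + (P + t * P))) ∎
  where
    open ≤-Reasoning
    x = ℓ ∸ P
    ℓ≤2x : ℓ ≤ x + x
    ℓ≤2x = ≤-trans (m≤n+m∸n ℓ P) (+-monoˡ-≤ x (m+n≤o⇒m≤o∸n P (<⇒≤ (≰⇒> ℓ≰2P))))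
    t*ℓ≤2R : t * ℓ ≤ R + R
    t*ℓ≤2R = ≤-trans (*-monoʳ-≤ t ℓ≤2x) (≤-trans (≤-reflexive (*-distribˡ-+ t x x)) (+-mono-≤ t*excess≤R t*excess≤R))
    rearrange : ∀ a c → a + (a + (c + c)) ≡ (c + a) + (c + a)
    rearrange = solve 2 (λ a c → a :+ (a :+ (c :+ c)) := (c :+ a) :+ (c :+ a)) refl

balanced⇒load-bound : ∀ {m P} {ℓ : Fin m → ℕ} → Balanced P ℓ → ∀ i →
                      m * ℓ i ≤ sum (map ℓ (allFin m)) + (sum (map ℓ (allFin m)) ⊔ m * P)
balanced⇒load-bound {suc s} {P} {ℓ} bal i =
  subst (λ T → suc s * ℓ i ≤ T + (T ⊔ suc s * P)) (sym total≡)
    (excess-bound⇒load-bound s (subst (λ l → (l ∸ 1) * (ℓ i ∸ P) ≤ sum (map ℓ others)) length-others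
      (bal i others-unique i∉others)))
  where
    machines = allFin (suc s)
    others = filter (¬? ∘ (_≟ i)) machines
    others-unique = Unique.filter⁺ (¬? ∘ (_≟ i)) (Unique.allFin⁺ (suc s))
    i∉others : i ∉ others
    i∉others i∈ = proj₂ (∈-filter⁻ (¬? ∘ (_≟ i)) {xs = machines} i∈) refl
    only-i : filter (_≟ i) machines ≡ i ∷ []
    only-i = filter-≟-singleton (Unique.allFin⁺ (suc s)) (∈-allFin i)
    length-others : length others ≡ s
    length-others = suc-injective (sym (begin
      suc s                                               ≡⟨ length-tabulate {n = suc s} (λ k → k) ⟨
      length machines                                     ≡⟨ length-filter-split (_≟ i) machines ⟩
      length (filter (_≟ i) machines) + length others     ≡⟨ cong (λ L → length L + length others) only-i ⟩
      suc (length others)                                 ∎))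
      where open ≡-Reasoning
    total≡ : sum (map ℓ machines) ≡ sum (map ℓ others) + ℓ i
    total≡ = begin
      sum (map ℓ machines)                                          ≡⟨ sum-filter-split (_≟ i) ℓ machines ⟩
      sum (map ℓ (filter (_≟ i) machines)) + sum (map ℓ others)     ≡⟨ cong (λ L → sum (map ℓ L) + sum (map ℓ others)) only-i ⟩
      (ℓ i + 0) + sum (map ℓ others)                                ≡⟨ cong (_+ sum (map ℓ others)) (+-identityʳ (ℓ i)) ⟩
      ℓ i + sum (map ℓ others)                                      ≡⟨ +-comm (ℓ i) _ ⟩
      sum (map ℓ others) + ℓ i                                      ∎
      where open ≡-Reasoning

module _ {A B : Set} where

  Unique-map⇒∈-injective : ∀ (f : A → B) {xs x y} → Unique (map f xs) → x ∈ xs → y ∈ xs → f x ≡ f y → x ≡ y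
  Unique-map⇒∈-injective f {_ ∷ _} _          (here refl) (here refl) _   = refl
  Unique-map⇒∈-injective f {_ ∷ _} (fx∉ ∷ _) (here refl) (there y∈)  fx≡fy =
    ⊥-elim (All.lookup fx∉ (∈-map⁺ f y∈) fx≡fy)
  Unique-map⇒∈-injective f {_ ∷ _} (fy∉ ∷ _) (there x∈)  (here refl) fx≡fy =
    ⊥-elim (All.lookup fy∉ (∈-map⁺ f x∈) (sym fx≡fy))
  Unique-map⇒∈-injective f {_ ∷ _} (_ ∷ u)    (there x∈)  (there y∈)  fx≡fy =
    Unique-map⇒∈-injective f u x∈ y∈ fx≡fy

  map-proj₁-zip-⊆ : ∀ (xs : List A) (ys : List B) → map proj₁ (zip xs ys) ⊆ xs
  map-proj₁-zip-⊆ []       _        = []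
  map-proj₁-zip-⊆ (x ∷ xs) []       = minimum (x ∷ xs)
  map-proj₁-zip-⊆ (x ∷ xs) (y ∷ ys) = refl ∷ map-proj₁-zip-⊆ xs ys

  map-proj₂-zip-⊆ : ∀ (xs : List A) (ys : List B) → map proj₂ (zip xs ys) ⊆ ys
  map-proj₂-zip-⊆ []       ys       = minimum ys
  map-proj₂-zip-⊆ (_ ∷ _)  []       = []
  map-proj₂-zip-⊆ (x ∷ xs) (y ∷ ys) = refl ∷ map-proj₂-zip-⊆ xs ys

module _ {A : Set} where

  Unique-++⇒disjoint : ∀ {x : A} xs {ys} → Unique (xs ++ ys) → x ∈ xs → x ∉ ys
  Unique-++⇒disjoint (_ ∷ xs) (x∉ ∷ _)  (here refl) x∈ys = All.lookup x∉ (∈-++⁺ʳ xs x∈ys) refl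
  Unique-++⇒disjoint (_ ∷ xs) (_ ∷ uxs) (there x∈)  x∈ys = Unique-++⇒disjoint xs uxs x∈ x∈ys

  AllPairs-resp-⊆ : ∀ {R : A → A → Set} {xs ys} → xs ⊆ ys → AllPairs R ys → AllPairs R xs
  AllPairs-resp-⊆ []         []         = []
  AllPairs-resp-⊆ (_ ∷ʳ τ)   (_ ∷ rys)  = AllPairs-resp-⊆ τ rys
  AllPairs-resp-⊆ (refl ∷ τ) (ry ∷ rys) = All-resp-⊆ τ ry ∷ AllPairs-resp-⊆ τ rys

  dropLast-⊆ : ∀ (xs : List A) → dropLast xs ⊆ xs
  dropLast-⊆ []           = []
  dropLast-⊆ (x ∷ [])     = x ∷ʳ []
  dropLast-⊆ (x ∷ y ∷ xs) = refl ∷ dropLast-⊆ (y ∷ xs)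

  DropsAtMostOne : List A → List A → Set
  DropsAtMostOne xs ys = ∃ λ z → ∀ {x} → x ∈ xs → x ∈ ys ⊎ just x ≡ z

  dropLast-dropsAtMostOne : ∀ (xs : List A) → DropsAtMostOne xs (dropLast xs)
  dropLast-dropsAtMostOne xs = last xs , cover xs
    where
      cover : ∀ xs {x} → x ∈ xs → x ∈ dropLast xs ⊎ just x ≡ last xs
      cover (_ ∷ [])     (here refl) = inj₂ refl
      cover (_ ∷ _ ∷ _)  (here refl) = inj₁ (here refl)
      cover (_ ∷ y ∷ xs) (there x∈) with cover (y ∷ xs) x∈
      ... | inj₁ x∈′ = inj₁ (there x∈′)
      ... | inj₂ x≡  = inj₂ x≡

module _ {m : ℕ} (M′ : Fin m) (LM : List (Fin m)) where

  removeMachine-⊆ : removeMachine M′ LM ⊆ LM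
  removeMachine-⊆ with any? (M′ ≟_) LM
  ... | yes _ = filter-⊆ (¬? ∘ (_≟ M′)) LM
  ... | no  _ = dropLast-⊆ LM

  removeMachine-dropsAtMostOne : DropsAtMostOne LM (removeMachine M′ LM)
  removeMachine-dropsAtMostOne with any? (M′ ≟_) LM
  ... | yes _ = just M′ , λ {y} y∈ → case y ≟ M′ of λ where
                  (yes refl) → inj₂ refl
                  (no y≢M′)  → inj₁ (∈-filter⁺ (¬? ∘ (_≟ M′)) y∈ y≢M′)
  ... | no  _ = dropLast-dropsAtMostOne LM

module _ {n m : ℕ} where

  _[_↦_] : Assign n m → Fin n → Fin m → Assign n m
  (a [ j ↦ M ]) k with j ≟ k
  ... | yes _ = just M
  ... | no  _ = a k

  update-≢ : ∀ a {j k} M → j ≢ k → (a [ j ↦ M ]) k ≡ a k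
  update-≢ a {j} {k} M j≢k with j ≟ k
  ... | yes j≡k = ⊥-elim (j≢k j≡k)
  ... | no  _   = refl

  lookupJob-∉ : ∀ (ps : List (Fin n × Fin m)) {j} → j ∉ map proj₁ ps → lookupJob ps j ≡ nothing
  lookupJob-∉ []             _  = refl
  lookupJob-∉ ((k , _) ∷ ps) {j} j∉ with k ≟ j
  ... | yes k≡j = ⊥-elim (j∉ (here (sym k≡j)))
  ... | no  _   = lookupJob-∉ ps (j∉ ∘ there)

  applyPairs-∉ : ∀ (a : Assign n m) ps {j} → j ∉ map proj₁ ps → applyPairs a ps j ≡ a j
  applyPairs-∉ a ps {j} j∉ with lookupJob ps j | lookupJob-∉ ps j∉
  ... | nothing | _ = refl

  applyPairs-∷ : ∀ (a : Assign n m) j M′ ps k → applyPairs a ((j , M′) ∷ ps) k ≡ (applyPairs a ps [ j ↦ M′ ]) k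
  applyPairs-∷ a j M′ ps k with j ≟ k
  ... | yes _ = refl
  ... | no  _ with lookupJob ps k
  ...   | just _  = refl
  ...   | nothing = refl

module _ {n m : ℕ} (p : Fin n → ℕ) where

  partialLoad : Assign n m → Fin m → List (Fin n) → ℕ
  partialLoad a M js = sum (map p (filter (λ j → ≡-dec _≟_ (a j) (just M)) js))

  partialLoad-cong : ∀ {a b} M js → (∀ {j} → j ∈ js → a j ≡ b j) → partialLoad a M js ≡ partialLoad b M js
  partialLoad-cong     M []       _   = refl
  partialLoad-cong {a} {b} M (j ∷ js) a≗b with ≡-dec _≟_ (a j) (just M) | ≡-dec _≟_ (b j) (just M)
  ... | yes _   | yes _   = cong (p j +_) (partialLoad-cong M js (a≗b ∘ there))
  ... | no  _   | no  _   = partialLoad-cong M js (a≗b ∘ there)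
  ... | yes a≡M | no  b≢M = ⊥-elim (b≢M (trans (sym (a≗b (here refl))) a≡M))
  ... | no  a≢M | yes b≡M = ⊥-elim (a≢M (trans (a≗b (here refl)) b≡M))

  load-emptyAssign : ∀ M → load p emptyAssign M ≡ 0
  load-emptyAssign M = go (allFin n)
    where
      go : ∀ js → partialLoad emptyAssign M js ≡ 0
      go []       = refl
      go (_ ∷ js) = go js

  pairGain : Fin n × Fin m → Fin m → ℕ
  pairGain (j , M′) M with M′ ≟ M
  ... | yes _ = p j
  ... | no  _ = 0

  pairGain-≢ : ∀ j {M′ M} → M′ ≢ M → pairGain (j , M′) M ≡ 0
  pairGain-≢ j {M′} {M} M′≢M with M′ ≟ M
  ... | yes M′≡M = ⊥-elim (M′≢M M′≡M)
  ... | no  _    = refl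

  pairGain-≡ : ∀ j M → pairGain (j , M) M ≡ p j
  pairGain-≡ j M with M ≟ M
  ... | yes _   = refl
  ... | no  M≢M = ⊥-elim (M≢M refl)

  gain : List (Fin n × Fin m) → Fin m → ℕ
  gain ps M = sum (map (λ e → pairGain e M) ps)

  partialLoad-update : ∀ a j M′ M {js} → Unique js → j ∈ js → a j ≡ nothing
                     → partialLoad (a [ j ↦ M′ ]) M js ≡ pairGain (j , M′) M + partialLoad a M js
  partialLoad-update a j M′ M {j ∷ js} (j∉ ∷ _) (here refl) aj≡nothing = at-head
    where
      rest : partialLoad (a [ j ↦ M′ ]) M js ≡ partialLoad a M js
      rest = partialLoad-cong M js (update-≢ a M′ ∘ All.lookup j∉)
      at-head : partialLoad (a [ j ↦ M′ ]) M (j ∷ js) ≡ pairGain (j , M′) M + partialLoad a M (j ∷ js)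
      at-head with j ≟ j
      ... | no j≢j = ⊥-elim (j≢j refl)
      ... | yes _ rewrite aj≡nothing with M′ ≟ M
      ...   | yes refl = cong (p j +_) rest
      ...   | no  _    = rest
  partialLoad-update a j M′ M {k ∷ js} (k∉ ∷ ujs) (there j∈) aj≡nothing
    rewrite update-≢ a M′ (λ j≡k → All.lookup k∉ j∈ (sym j≡k)) with ≡-dec _≟_ (a k) (just M)
  ... | yes _ = trans (cong (p k +_) ih) (x∙yz≈y∙xz (p k) (pairGain (j , M′) M) _)
    where ih = partialLoad-update a j M′ M ujs j∈ aj≡nothing
  ... | no  _ = partialLoad-update a j M′ M ujs j∈ aj≡nothing

  load-applyPairs : ∀ a ps M → All (λ j → a j ≡ nothing) (map proj₁ ps) → Unique (map proj₁ ps)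
                  → load p (applyPairs a ps) M ≡ load p a M + gain ps M
  load-applyPairs a []               M _ _ = sym (+-identityʳ _)
  load-applyPairs a ((j , M′) ∷ ps) M (aj≡nothing ∷ fresh) (j∉ ∷ ujs) = begin
    load p (applyPairs a ((j , M′) ∷ ps)) M
      ≡⟨ partialLoad-cong M (allFin n) (λ {k} _ → applyPairs-∷ a j M′ ps k) ⟩
    partialLoad (applyPairs a ps [ j ↦ M′ ]) M (allFin n)
      ≡⟨ partialLoad-update (applyPairs a ps) j M′ M (Unique.allFin⁺ n) (∈-allFin j) still-fresh ⟩
    pairGain (j , M′) M + load p (applyPairs a ps) M
      ≡⟨ cong (pairGain (j , M′) M +_) (load-applyPairs a ps M fresh ujs) ⟩
    pairGain (j , M′) M + (load p a M + gain ps M)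
      ≡⟨ x∙yz≈y∙xz (pairGain (j , M′) M) (load p a M) (gain ps M) ⟩
    load p a M + gain ((j , M′) ∷ ps) M
      ∎
    where
      open ≡-Reasoning
      still-fresh : applyPairs a ps j ≡ nothing
      still-fresh = trans (applyPairs-∉ a ps (λ j∈ → All.lookup j∉ j∈ refl)) aj≡nothing

  gain-∉ : ∀ ps {M} → M ∉ map proj₂ ps → gain ps M ≡ 0
  gain-∉ []              _  = refl
  gain-∉ ((j , M′) ∷ ps) M∉ =
    cong₂ _+_ (pairGain-≢ j (λ M′≡M → M∉ (here (sym M′≡M)))) (gain-∉ ps (M∉ ∘ there))

  gain-≤ : ∀ ps {c} M → All (λ j → p j ≤ c) (map proj₁ ps) → Unique (map proj₂ ps) → gain ps M ≤ c
  gain-≤ []              M _               _          = z≤n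
  gain-≤ ((j , M′) ∷ ps) M (pj≤c ∷ ps≤c) (M′∉ ∷ ums) with M′ ≟ M
  ... | yes refl = begin
    p j + gain ps M′  ≡⟨ cong (p j +_) (gain-∉ ps (λ M′∈ → All.lookup M′∉ M′∈ refl)) ⟩
    p j + 0           ≡⟨ +-identityʳ (p j) ⟩
    p j               ≤⟨ pj≤c ⟩
    _                 ∎
    where open ≤-Reasoning
  ... | no  _    = gain-≤ ps M ps≤c ums

  gain-zip-antitone : ∀ (ℓ : Fin m → ℕ) {js Ms} → AllPairs (λ j k → p k ≤ p j) js
                    → AllPairs (λ M M′ → ℓ M ≤ ℓ M′) Ms → Unique Ms
                    → ∀ {i y} → i ∈ map proj₂ (zip js Ms) → y ∈ Ms → ℓ y < ℓ i
                    → gain (zip js Ms) i ≤ gain (zip js Ms) y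
  gain-zip-antitone ℓ {j ∷ js} {M ∷ Ms} _ _ _ (here refl) (here refl) ℓy<ℓi = ⊥-elim (<-irrefl refl ℓy<ℓi)
  gain-zip-antitone ℓ {j ∷ js} {M ∷ Ms} _ (ℓM≤ ∷ _) _ (here refl) (there y∈) ℓy<ℓi =
    ⊥-elim (<⇒≱ ℓy<ℓi (All.lookup ℓM≤ y∈))
  gain-zip-antitone ℓ {j ∷ js} {M ∷ Ms} (pj≥ ∷ _) _ (M∉ ∷ uMs) {i} (there i∈) (here refl) _ = begin
    pairGain (j , M) i + gain (zip js Ms) i     ≡⟨ cong (_+ gain (zip js Ms) i) (pairGain-≢ j M≢i) ⟩
    gain (zip js Ms) i                          ≤⟨ gain-≤ (zip js Ms) i (All-resp-⊆ (map-proj₁-zip-⊆ js Ms) pj≥)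
                                                     (AllPairs-resp-⊆ (map-proj₂-zip-⊆ js Ms) uMs) ⟩
    p j                                         ≡⟨ +-identityʳ (p j) ⟨
    p j + 0                                     ≡⟨ cong₂ _+_ (pairGain-≡ j M) (gain-∉ (zip js Ms) M∉rest) ⟨
    pairGain (j , M) M + gain (zip js Ms) M     ∎
    where
      open ≤-Reasoning
      M≢i : M ≢ i
      M≢i = All.lookup M∉ (Any-resp-⊆ (map-proj₂-zip-⊆ js Ms) i∈)
      M∉rest : M ∉ map proj₂ (zip js Ms)
      M∉rest M∈ = All.lookup M∉ (Any-resp-⊆ (map-proj₂-zip-⊆ js Ms) M∈) refl
  gain-zip-antitone ℓ {j ∷ js} {M ∷ Ms} (_ ∷ sorted-js) (_ ∷ sorted-Ms) (M∉ ∷ uMs) (there i∈) (there y∈) ℓy<ℓi =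
    subst₂ _≤_ (head-irrelevant (Any-resp-⊆ (map-proj₂-zip-⊆ js Ms) i∈)) (head-irrelevant y∈)
      (gain-zip-antitone ℓ sorted-js sorted-Ms uMs i∈ y∈ ℓy<ℓi)
    where
      head-irrelevant : ∀ {k} → k ∈ Ms → gain (zip js Ms) k ≡ pairGain (j , M) k + gain (zip js Ms) k
      head-irrelevant k∈ = cong (_+ gain (zip js Ms) _) (sym (pairGain-≢ j (All.lookup M∉ k∈)))

module _ {n m : ℕ} (a : Assign n m) (LJ : List (Fin n)) (LM : List (Fin m)) where

  record Adjustment (r : List (Fin n) × List (Fin m)) : Set where
    field
      jobs-⊆        : proj₁ r ⊆ LJ
      jobs-fresh    : All (λ j → a j ≡ nothing) (proj₁ r)
      machines-⊆    : proj₂ r ⊆ LM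
      machines-drop : DropsAtMostOne LM (proj₂ r)

  OnlyParentAssigned : Maybe (Fin n) → Set
  OnlyParentAssigned u = ∀ {j} → j ∈ LJ → a j ≢ nothing → u ≡ just j

  fresh-unless-parent : ∀ {u} → OnlyParentAssigned u → ∀ {j} → j ∈ LJ
                      → (u ≡ just j → a j ≡ nothing) → a j ≡ nothing
  fresh-unless-parent only-parent {j} j∈ h with ≡-dec _≟_ (a j) nothing
  ... | yes aj≡nothing = aj≡nothing
  ... | no  aj≢nothing = h (only-parent j∈ aj≢nothing)

  unchanged-adjustment : All (λ j → a j ≡ nothing) LJ → Adjustment (LJ , LM)
  unchanged-adjustment fresh = record
    { jobs-⊆        = ⊆-refl
    ; jobs-fresh    = fresh
    ; machines-⊆    = ⊆-refl
    ; machines-drop = nothing , inj₁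
    }

  adjust-adjustment : ∀ u → OnlyParentAssigned u → Adjustment (adjust a u LJ LM)
  adjust-adjustment nothing  only-parent =
    unchanged-adjustment (All.tabulate λ j∈ → fresh-unless-parent only-parent j∈ λ ())
  adjust-adjustment (just v) only-parent with a v in av
  ... | nothing = unchanged-adjustment (All.tabulate λ j∈ → fresh-unless-parent only-parent j∈ λ { refl → av })
  ... | just M′ = record
    { jobs-⊆        = filter-⊆ (¬? ∘ (_≟ v)) LJ
    ; jobs-fresh    = All.tabulate λ j∈ → let j∈LJ , j≢v = ∈-filter⁻ (¬? ∘ (_≟ v)) {xs = LJ} j∈ in
                        fresh-unless-parent only-parent j∈LJ λ { refl → ⊥-elim (j≢v refl) }
    ; machines-⊆    = removeMachine-⊆ M′ LM
    ; machines-drop = removeMachine-dropsAtMostOne M′ LM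
    }

module _ {n m : ℕ} {a : Assign n m} {u LJ LM} (adj : Adjustment a LJ LM (adjust a u LJ LM)) where

  open Adjustment adj

  next-changes-only : ∀ j → j ∈ LJ ⊎ next a u LJ LM j ≡ a j
  next-changes-only j with any? (j ≟_) (map proj₁ (zip (proj₁ (adjust a u LJ LM)) (proj₂ (adjust a u LJ LM))))
  ... | yes j∈ = inj₁ (Any-resp-⊆ (⊆-trans (map-proj₁-zip-⊆ _ _) jobs-⊆) j∈)
  ... | no  j∉ = inj₂ (applyPairs-∉ a _ j∉)

  next-balanced : ∀ (p : Fin n → ℕ) {B} → ValidChoice p a B LJ LM
                → Balanced (pmax p) (load p a) → Balanced (pmax p) (load p (next a u LJ LM))
  next-balanced p (LJ↭B , LJ-sorted , LM-unique , _ , LM-sorted , LM-least) bal =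
    Balanced-resp-≗ {P = pmax p} (λ k → sym (load-applyPairs p a ps k ps-fresh ps-jobs-unique))
      (balanced-+ {P = pmax p} (proj₁ machines-drop) gain≤pmax antitone bal)
    where
      LJ′ = proj₁ (adjust a u LJ LM)
      LM′ = proj₂ (adjust a u LJ LM)
      ps  = zip LJ′ LM′
      ℓ   = load p a
      LJ-unique : Unique LJ
      LJ-unique = Unique-resp-↭ (setoid _) (↭⇒↭ₛ (↭-sym LJ↭B)) (Unique.filter⁺ _ (Unique.allFin⁺ n))
      LJ′-sorted : AllPairs (λ j k → p k ≤ p j) LJ′
      LJ′-sorted = AllPairs-resp-⊆ jobs-⊆ (Linked⇒AllPairs (λ pk≤pj pl≤pk → ≤-trans pl≤pk pk≤pj) LJ-sorted)
      LM′-sorted : AllPairs (λ M M′ → ℓ M ≤ ℓ M′) LM′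
      LM′-sorted = AllPairs-resp-⊆ machines-⊆ (Linked⇒AllPairs ≤-trans LM-sorted)
      LM′-unique : Unique LM′
      LM′-unique = AllPairs-resp-⊆ machines-⊆ LM-unique
      ps-fresh : All (λ j → a j ≡ nothing) (map proj₁ ps)
      ps-fresh = All-resp-⊆ (map-proj₁-zip-⊆ LJ′ LM′) jobs-fresh
      ps-jobs-unique : Unique (map proj₁ ps)
      ps-jobs-unique = AllPairs-resp-⊆ (⊆-trans (map-proj₁-zip-⊆ LJ′ LM′) jobs-⊆) LJ-unique
      ps-machines-unique : Unique (map proj₂ ps)
      ps-machines-unique = AllPairs-resp-⊆ (map-proj₂-zip-⊆ LJ′ LM′) LM′-unique
      gain≤pmax : ∀ k → gain p ps k ≤ pmax p
      gain≤pmax k = gain-≤ p ps k (All.tabulate λ _ → p≤pmax p _) ps-machines-unique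
      antitone : ∀ {i y} → ℓ y < ℓ i → just y ≢ proj₁ machines-drop → gain p ps i ≤ gain p ps y
      antitone {i} {y} ℓy<ℓi y≢dropped with any? (i ≟_) (map proj₂ ps)
      ... | no  i∉ = ≤-trans (≤-reflexive (gain-∉ p ps i∉)) z≤n
      ... | yes i∈ with any? (y ≟_) LM
      ...   | no  y∉ =
        ⊥-elim (<⇒≱ ℓy<ℓi (LM-least i y (Any-resp-⊆ (⊆-trans (map-proj₂-zip-⊆ LJ′ LM′) machines-⊆) i∈) y∉))
      ...   | yes y∈ with proj₂ machines-drop y∈
      ...     | inj₂ y≡dropped = ⊥-elim (y≢dropped y≡dropped)
      ...     | inj₁ y∈LM′     = gain-zip-antitone p ℓ LJ′-sorted LM′-sorted LM′-unique i∈ y∈LM′ ℓy<ℓi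

module _ {A : Set} where

  data ParentsFirst (seen : List A) : List (Maybe A × A) → Set where
    []  : ParentsFirst seen []
    _∷_ : ∀ {mp x es} → Maybe.All (_∈ seen) mp → ParentsFirst (x ∷ seen) es → ParentsFirst seen ((mp , x) ∷ es)

  seenAfter : List (Maybe A × A) → List A → List A
  seenAfter []             seen = seen
  seenAfter ((_ , x) ∷ es) seen = seenAfter es (x ∷ seen)

  seenAfter-⊇ : ∀ es {seen x} → x ∈ seen → x ∈ seenAfter es seen
  seenAfter-⊇ []             x∈ = x∈
  seenAfter-⊇ ((_ , _) ∷ es) x∈ = seenAfter-⊇ es (there x∈)

  parentsFirst-++⁺ : ∀ {seen} es {fs} → ParentsFirst seen es → ParentsFirst (seenAfter es seen) fs
                   → ParentsFirst seen (es ++ fs)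
  parentsFirst-++⁺ []             []          pf = pf
  parentsFirst-++⁺ ((_ , _) ∷ es) (ok ∷ pes) pf = ok ∷ parentsFirst-++⁺ es pes pf

  parentsFirst-++⁻ˡ : ∀ {seen} es {fs} → ParentsFirst seen (es ++ fs) → ParentsFirst seen es
  parentsFirst-++⁻ˡ []             _          = []
  parentsFirst-++⁻ˡ ((_ , _) ∷ es) (ok ∷ pf) = ok ∷ parentsFirst-++⁻ˡ es pf

  parentsFirst-parent : ∀ {seen es x y} → ParentsFirst seen es → (just x , y) ∈ es → x ∈ seen ⊎ x ∈ map proj₂ es
  parentsFirst-parent (Maybe.just x∈ ∷ _) (here refl) = inj₁ x∈
  parentsFirst-parent (_ ∷ pf)           (there e∈) with parentsFirst-parent pf e∈
  ... | inj₁ (here refl) = inj₂ (here refl)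
  ... | inj₁ (there x∈)  = inj₁ x∈
  ... | inj₂ x∈          = inj₂ (there x∈)

  mutual
    preorder-parentsFirst : ∀ t {seen mp} → Maybe.All (_∈ seen) mp → ParentsFirst seen (preorder mp t)
    preorder-parentsFirst (node x ts) ok = ok ∷ preorderF-parentsFirst ts (Maybe.just (here refl))

    preorderF-parentsFirst : ∀ ts {seen mp} → Maybe.All (_∈ seen) mp → ParentsFirst seen (preorderF mp ts)
    preorderF-parentsFirst []       ok = []
    preorderF-parentsFirst (t ∷ ts) {mp = mp} ok =
      parentsFirst-++⁺ (preorder mp t) (preorder-parentsFirst t ok)
        (preorderF-parentsFirst ts (Maybe.map (seenAfter-⊇ (preorder mp t)) ok))

module _ {n : ℕ} (G : Graph n) (F : Forest n) (bcf : IsBlockCutForest G F) where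

  private
    E = entries F

  -- j is a cut-vertex of S and of the earlier S′.  Were S the parent of cut j, then cut j
  -- would follow S, yet it is adjacent to S′ too: as its child (so S′ = S) or as its
  -- parent (so cut j precedes S′).
  shared-job-is-parent-cut : ∀ X Y → X ++ Y ≡ E → ∀ {par S par′ S′ j}
                           → (par , blk S) ∈ Y → (par′ , blk S′) ∈ X → j ∈ₛ S → j ∈ₛ S′ → par ≡ just (cut j)
  shared-job-is-parent-cut X Y X++Y≡E {par} {S} {par′} {S′} {j} S∈Y S′∈X j∈S j∈S′ =
    [ ⊥-elim ∘ cut-not-child-of-S , (λ cut-parent-of-S → cong proj₁ (same-label S∈E cut-parent-of-S refl)) ]′
      (cut-adjacent S j S-block j-cut j∈S)
    where
      labels-unique = proj₁ bcf
      labels-nodes  = proj₁ (proj₂ bcf)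
      cut-adjacent  = proj₂ (proj₂ (proj₂ (proj₂ bcf)))

      to-X++Y : ∀ {e} → e ∈ E → e ∈ X ++ Y
      to-X++Y = subst (_ ∈_) (sym X++Y≡E)
      S∈E  = subst (_ ∈_) X++Y≡E (∈-++⁺ʳ X S∈Y)
      S′∈E = subst (_ ∈_) X++Y≡E (∈-++⁺ˡ S′∈X)

      same-label : ∀ {e e′} → e ∈ E → e′ ∈ E → proj₂ e ≡ proj₂ e′ → e ≡ e′
      same-label = Unique-map⇒∈-injective proj₂ labels-unique

      labels-disjoint : ∀ {x} → x ∈ map proj₂ X → x ∉ map proj₂ Y
      labels-disjoint = Unique-++⇒disjoint (map proj₂ X)
        (subst Unique (map-++ proj₂ X Y) (subst (Unique ∘ map proj₂) (sym X++Y≡E) labels-unique))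

      parent∈labels-X : ∀ {x y} → (just x , y) ∈ X → x ∈ map proj₂ X
      parent∈labels-X e∈ with parentsFirst-parent
        (parentsFirst-++⁻ˡ X (subst (ParentsFirst []) (sym X++Y≡E) (preorderF-parentsFirst F Maybe.nothing))) e∈
      ... | inj₁ ()
      ... | inj₂ x∈ = x∈

      S≢S′ : S ≢ S′
      S≢S′ refl = labels-disjoint (∈-map⁺ proj₂ S′∈X) (∈-map⁺ proj₂ S∈Y)

      S-block  = labels-nodes (blk S) (∈-map⁺ proj₂ S∈E)
      S′-block = labels-nodes (blk S′) (∈-map⁺ proj₂ S′∈E)
      j-cut : IsCutVertex G j
      j-cut = S , S′ , S≢S′ , S-block , S′-block , j∈S , j∈S′

      blk-injective : ∀ {T T′ : Subset n} → blk T ≡ blk T′ → T ≡ T′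
      blk-injective refl = refl

      cut-not-child-of-S : (just (blk S) , cut j) ∈ E → ⊥
      cut-not-child-of-S S-parent-of-cut with ∈-++⁻ X (to-X++Y S-parent-of-cut)
      ... | inj₁ S-parent-of-cut∈X = labels-disjoint (parent∈labels-X S-parent-of-cut∈X) (∈-map⁺ proj₂ S∈Y)
      ... | inj₂ S-parent-of-cut∈Y with cut-adjacent S′ j S′-block j-cut j∈S′
      ...   | inj₁ S′-parent-of-cut =
                S≢S′ (blk-injective (just-injective (cong proj₁ (same-label S-parent-of-cut S′-parent-of-cut refl))))
      ...   | inj₂ cut-parent-of-S′ =
                labels-disjoint (parent∈labels-X (subst (_∈ X) (same-label S′∈E cut-parent-of-S′ refl) S′∈X))
                                (∈-map⁺ proj₂ S-parent-of-cut∈Y)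

parentCut : ∀ {n} → Maybe (TNode n) → Maybe (Fin n)
parentCut (just (cut v)) = just v
parentCut (just (blk _)) = nothing
parentCut nothing        = nothing

blockSeq'-cut : ∀ {n} (mp : Maybe (TNode n)) v es → blockSeq' ((mp , cut v) ∷ es) ≡ blockSeq' es
blockSeq'-cut nothing        _ _ = refl
blockSeq'-cut (just (blk _)) _ _ = refl
blockSeq'-cut (just (cut _)) _ _ = refl

blockSeq'-blk : ∀ {n} (mp : Maybe (TNode n)) S es → blockSeq' ((mp , blk S) ∷ es) ≡ (S , parentCut mp) ∷ blockSeq' es
blockSeq'-blk nothing        _ _ = refl
blockSeq'-blk (just (blk _)) _ _ = refl
blockSeq'-blk (just (cut _)) _ _ = refl

module _ {n m : ℕ} where

  CoveredBy : List (Maybe (TNode n) × TNode n) → Assign n m → Set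
  CoveredBy X a = ∀ j → a j ≢ nothing → ∃ λ S → ∃ λ par → (par , blk S) ∈ X × j ∈ₛ S

  CoveredBy-++ : ∀ {X a} Y → CoveredBy X a → CoveredBy (X ++ Y) a
  CoveredBy-++ Y covered j aj≢nothing =
    let S , par , e∈ , j∈S = covered j aj≢nothing in S , par , ∈-++⁺ˡ e∈ , j∈S

  LoadBound : (Fin n → ℕ) → Assign n m → Set
  LoadBound p a = ∀ (i : Fin m) → m * load p a i ≤ totalLoad p a + (totalLoad p a ⊔ m * pmax p)

module _ {n m : ℕ} (G : Graph n) (p : Fin n → ℕ) (F : Forest n) (bcf : IsBlockCutForest G F) where

  run-bounded : ∀ X Y → X ++ Y ≡ entries F → ∀ {a : Assign n m} {as} → Run p a (blockSeq' Y) as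
              → Balanced (pmax p) (load p a) → CoveredBy X a → All (LoadBound p) as
  run-bounded X [] _ done bal _ = balanced⇒load-bound bal ∷ []
  run-bounded X ((mp , cut v) ∷ Y) X++Y≡E {a} {as} run bal covered =
    run-bounded (X ++ (mp , cut v) ∷ []) Y (trans (++-assoc X _ Y) X++Y≡E)
      (subst (λ bs → Run p a bs as) (blockSeq'-cut mp v Y) run) bal (CoveredBy-++ _ covered)
  run-bounded X ((mp , blk S) ∷ Y) X++Y≡E {a} {as} run bal covered
    with subst (λ bs → Run p a bs as) (blockSeq'-blk mp S Y) run
  ... | step LJ LM choice run′ =
    balanced⇒load-bound bal ∷
    run-bounded (X ++ (mp , blk S) ∷ []) Y (trans (++-assoc X _ Y) X++Y≡E) run′
      (next-balanced {u = parentCut mp} adjustment p choice bal) covered′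
    where
      LJ⊆S : ∀ {j} → j ∈ LJ → j ∈ₛ S
      LJ⊆S j∈ = proj₂ (∈-filter⁻ (_∈ₛ? S) {xs = allFin n} (∈-resp-↭ (proj₁ choice) j∈))
      only-parent : OnlyParentAssigned a LJ LM (parentCut mp)
      only-parent {j} j∈ aj≢nothing =
        let S′ , par′ , e∈ , j∈S′ = covered j aj≢nothing in
        cong parentCut (shared-job-is-parent-cut G F bcf X ((mp , blk S) ∷ Y) X++Y≡E (here refl) e∈ (LJ⊆S j∈) j∈S′)
      adjustment : Adjustment a LJ LM (adjust a (parentCut mp) LJ LM)
      adjustment = adjust-adjustment a LJ LM (parentCut mp) only-parent
      covered′ : CoveredBy (X ++ (mp , blk S) ∷ []) (next a (parentCut mp) LJ LM)
      covered′ j next-j≢nothing with next-changes-only {u = parentCut mp} adjustment j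
      ... | inj₁ j∈LJ = S , mp , ∈-++⁺ʳ X (here refl) , LJ⊆S j∈LJ
      ... | inj₂ unchanged = CoveredBy-++ _ covered j (next-j≢nothing ∘ trans unchanged)

lemma1 : ∀ {n m : ℕ} (G : Graph n) (p : Fin n → ℕ)
    → IsBlockGraph G
    → (F : Forest n) → IsBlockCutForest G F
    → (states : List (Assign n m))
    → Run p emptyAssign (blockSeq F) states
    → All (λ a → ∀ (i : Fin m) →
    m * load p a i ≤ totalLoad p a + (totalLoad p a ⊔ m * pmax p)) states
lemma1 G p _ F bcf _ run =
  run-bounded G p F bcf [] (entries F) refl run
    (Balanced-resp-≗ {P = pmax p} (sym ∘ load-emptyAssign p) (balanced-zero {P = pmax p}))
    (λ j nothing≢nothing → ⊥-elim (nothing≢nothing refl))
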